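{- For every integer $m \ge 3$, we have $\chi'_{st}(C_m \,\square\, P_2) = 6$ if $m = 3$; $\chi'_{st}(C_m \,\square\, P_2) = 4$ if $m \equiv 0 \pmod 4$; and $\chi'_{st}(C_m \,\square\, P_2) = 5$ otherwise.
   Context: A star edge-coloring of a graph $G$ is a proper edge-coloring of $G$ in which there is no bichromatic path and no bichromatic cycle of length four (i.e., with four edges). The star chromatic index $\chi'_{st}(G)$ is the minimum number of colors in a star edge-coloring of $G$. $C_m$ denotes the cycle on $m$ vertices and $P_n$ the path on $n$ vertices. $G \,\square\, H$ denotes the Cartesian product: vertex set $V(G)\times V(H)$, with $(u,v)(u',v')$ an edge iff either $uu'\in E(G)$ and $v=v'$, or $u=u'$ and $vv'\in E(H)$. -}

module Defs where

open import Level using (0ℓ)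
open import Data.Nat using (ℕ; zero; suc; _<_)
open import Data.Fin using (Fin; toℕ)
open import Data.Product using (_×_; Σ)
open import Data.Sum using (_⊎_)
open import Relation.Binary.PropositionalEquality using (_≡_; _≢_)
open import Relation.Nullary using (¬_)

record Graph : Set₁ where
  field
    V   : Set
    Adj : V → V → Set
open Graph public

CycAdj : (m : ℕ) → Fin m → Fin m → Set
CycAdj m u v = suc (toℕ u) ≡ toℕ v ⊎ (suc (toℕ u) ≡ m × toℕ v ≡ 0)

Cycle : ℕ → Graph
Cycle m = record { V = Fin m ; Adj = λ u v → CycAdj m u v ⊎ CycAdj m v u }

Path : ℕ → Graph
Path n = record { V = Fin n
                ; Adj = λ u v → suc (toℕ u) ≡ toℕ v ⊎ suc (toℕ v) ≡ toℕ u }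

_□_ : Graph → Graph → Graph
G □ H = record
  { V   = V G × V H
  ; Adj = λ p q → (Adj G (Data.Product.proj₁ p) (Data.Product.proj₁ q)
                     × Data.Product.proj₂ p ≡ Data.Product.proj₂ q)
                ⊎ (Data.Product.proj₁ p ≡ Data.Product.proj₁ q
                     × Adj H (Data.Product.proj₂ p) (Data.Product.proj₂ q)) }

record EdgeColouring (G : Graph) (k : ℕ) : Set where
  field
    col : V G → V G → Fin k
    sym : ∀ u v → Adj G u v → col u v ≡ col v u
open EdgeColouring public

Proper : {G : Graph} {k : ℕ} → EdgeColouring G k → Set
Proper {G} c = ∀ u v w → Adj G u v → Adj G v w → u ≢ w → col c u v ≢ col c v w

-- No bichromatic path with four edges (v0..v4 all distinct) and no
-- bichromatic cycle with four edges (v0..v3 distinct, v4 = v0).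
-- Under properness a 4-edge walk is bichromatic iff its colours alternate a,b,a,b.
NoBichromatic4 : {G : Graph} {k : ℕ} → EdgeColouring G k → Set
NoBichromatic4 {G} c =
  ∀ v0 v1 v2 v3 v4 →
  Adj G v0 v1 → Adj G v1 v2 → Adj G v2 v3 → Adj G v3 v4 →
  v0 ≢ v1 → v0 ≢ v2 → v0 ≢ v3 → v1 ≢ v2 → v1 ≢ v3 → v2 ≢ v3 →
  v4 ≢ v1 → v4 ≢ v2 → v4 ≢ v3 →
  ¬ (col c v0 v1 ≡ col c v2 v3 × col c v1 v2 ≡ col c v3 v4)

StarEdgeColouring : (G : Graph) (k : ℕ) → EdgeColouring G k → Set
StarEdgeColouring G k c = Proper c × NoBichromatic4 c

StarColourable : Graph → ℕ → Set
StarColourable G k = Σ (EdgeColouring G k) (StarEdgeColouring G k)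

StarChromaticIndex : Graph → ℕ → Set
StarChromaticIndex G k = StarColourable G k × (∀ j → j < k → ¬ StarColourable G j)

module Submission where

-- A colouring of C_m □ P_2 is given column by column by a cyclic word of slices
-- (rung colour, top edge colour, bottom edge colour).  Being a star colouring is local: a bichromatic
-- 4-edge path or 4-cycle through a vertex stays within four columns of it, so it suffices to check
-- every window of eight columns of the word.  Words P^c Y made of a fixed 4-periodic block P and a
-- short tail Y give 4 colours when 4 ∣ m and 5 colours otherwise; m = 3 has its own 6-colouring.
--
-- The colours read off a few consecutive columns of a star colouring satisfy finitely
-- many local constraints (properness and no alternating 4-edge walk), and an exhaustive search shows
-- that they cannot be met with too few colours.  With 4 colours and m ≥ 5 the search shows instead
-- that the colours T x of the top cycle satisfy T (x + 4) = T x ≠ T (x + 2); since T is also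
-- m-periodic, 4 ∣ m.

open import Data.Bool using (Bool; true; false; T; _∧_; _∨_; not)
open import Data.Bool.ListAction using (any)
open import Data.Bool.Properties using (T-∧; T-∨; T-not-≡)
open import Data.Empty using (⊥-elim)
open import Data.Fin using (Fin; zero; suc; toℕ; opposite; inject≤; #_)
open import Data.Fin.Properties using (toℕ-injective; toℕ-fromℕ<; toℕ<n; inject≤-injective) renaming (_≟_ to _≟ᶠ_)
open import Data.List using (List; []; _∷_; _++_; _∷ʳ_; length; drop; map; filter; upTo; concatMap)
open import Data.List.Membership.Propositional using (_∈_; find)
open import Data.List.Membership.Propositional.Properties using (∈-map⁻; ∈-filter⁻)
open import Data.List.Properties using (++-assoc; ++-identityʳ; ∷ʳ-++; length-++; length-map; length-upTo)
open import Data.List.Relation.Unary.Any using (here; there)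
open import Data.List.Relation.Unary.Any.Properties using (any⁻)
open import Data.Maybe using (Maybe; just; nothing)
open import Data.Maybe.Properties using (just-injective)
open import Data.Nat using (ℕ; zero; suc; pred; _+_; _*_; _∸_; _⊔_; _≤_; _<_; z≤n; s≤s; s≤s⁻¹; z<s; s<s; _%_; _/_; NonZero; >-nonZero; _<?_; _≤?_; ∣_-_∣)
open import Data.Nat.DivMod using (_mod_; m%n<n; m<n⇒m%n≡m; n%n≡0; %-distribˡ-+; m%n%n≡m%n; [m+n]%n≡m%n; [m+kn]%n≡m%n; m≡m%n+[m/n]*n; m<n*o⇒m/o<n)
open import Data.Nat.Properties
open import Data.Product using (Σ; _×_; _,_; proj₁; proj₂)
open import Data.Product.Properties using (≡-dec)
open import Data.Sum using (_⊎_; inj₁; inj₂)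
open import Data.Unit using (⊤; tt)
open import Function using (_∘_; id; Equivalence)
open import Relation.Binary.Definitions using (DecidableEquality)
open import Relation.Binary.PropositionalEquality
open import Relation.Nullary using (¬_; Dec; yes; no; does)
open import Relation.Nullary.Decidable using (_×-dec_; _⊎-dec_; ¬?; map′; toWitness; True)
open import Defs hiding (sym)

Prism : ℕ → Graph
Prism m = Cycle m □ Path 2

Layer : Set
Layer = Fin 2

Adj-Path2⇒opposite : ∀ {a b : Layer} → Adj (Path 2) a b → b ≡ opposite a
Adj-Path2⇒opposite {zero}     {suc zero} _ = refl
Adj-Path2⇒opposite {suc zero} {zero}     _ = refl
Adj-Path2⇒opposite {zero}     {zero}     (inj₁ ())
Adj-Path2⇒opposite {zero}     {zero}     (inj₂ ())
Adj-Path2⇒opposite {suc zero} {suc zero} (inj₁ ())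
Adj-Path2⇒opposite {suc zero} {suc zero} (inj₂ ())

Adj-Prism-sym : ∀ {m} {p q : V (Prism m)} → Adj (Prism m) p q → Adj (Prism m) q p
Adj-Prism-sym (inj₁ (inj₁ c , e)) = inj₁ (inj₂ c , sym e)
Adj-Prism-sym (inj₁ (inj₂ c , e)) = inj₁ (inj₁ c , sym e)
Adj-Prism-sym (inj₂ (e , inj₁ c)) = inj₂ (sym e , inj₂ c)
Adj-Prism-sym (inj₂ (e , inj₂ c)) = inj₂ (sym e , inj₁ c)

module Cyclic (m : ℕ) .{{_ : NonZero m}} where

  ⟦_⟧ : ℕ → Fin m
  ⟦ x ⟧ = x mod m

  toℕ-⟦⟧ : ∀ x → toℕ ⟦ x ⟧ ≡ x % m
  toℕ-⟦⟧ x = toℕ-fromℕ< (m%n<n x m)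

  ⟦⟧≡⇒%≡ : ∀ {x y} → ⟦ x ⟧ ≡ ⟦ y ⟧ → x % m ≡ y % m
  ⟦⟧≡⇒%≡ {x} {y} e = trans (sym (toℕ-⟦⟧ x)) (trans (cong toℕ e) (toℕ-⟦⟧ y))

  %≡⇒⟦⟧≡ : ∀ {x y} → x % m ≡ y % m → ⟦ x ⟧ ≡ ⟦ y ⟧
  %≡⇒⟦⟧≡ {x} {y} e = toℕ-injective (trans (toℕ-⟦⟧ x) (trans e (sym (toℕ-⟦⟧ y))))

  ⟦toℕ⟧ : ∀ (i : Fin m) → ⟦ toℕ i ⟧ ≡ i
  ⟦toℕ⟧ i = toℕ-injective (trans (toℕ-⟦⟧ (toℕ i)) (m<n⇒m%n≡m (toℕ<n i)))

  ⟦%⟧ : ∀ x → ⟦ x % m ⟧ ≡ ⟦ x ⟧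
  ⟦%⟧ x = %≡⇒⟦⟧≡ (m%n%n≡m%n x m)

  ⟦+⟧-congˡ : ∀ c {x y} → ⟦ x ⟧ ≡ ⟦ y ⟧ → ⟦ c + x ⟧ ≡ ⟦ c + y ⟧
  ⟦+⟧-congˡ c {x} {y} e = %≡⇒⟦⟧≡ (begin
    (c + x) % m              ≡⟨ %-distribˡ-+ c x m ⟩
    (c % m + x % m) % m      ≡⟨ cong (λ z → (c % m + z) % m) (⟦⟧≡⇒%≡ e) ⟩
    (c % m + y % m) % m      ≡⟨ %-distribˡ-+ c y m ⟨
    (c + y) % m              ∎)
    where open ≡-Reasoning

  ⟦suc⟧-cong : ∀ {x y} → ⟦ x ⟧ ≡ ⟦ y ⟧ → ⟦ suc x ⟧ ≡ ⟦ suc y ⟧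
  ⟦suc⟧-cong = ⟦+⟧-congˡ 1

  ⟦+m⟧ : ∀ x → ⟦ x + m ⟧ ≡ ⟦ x ⟧
  ⟦+m⟧ x = %≡⇒⟦⟧≡ ([m+n]%n≡m%n x m)

  ⟦+⟧-cancelˡ : ∀ c {x y} → ⟦ c + x ⟧ ≡ ⟦ c + y ⟧ → ⟦ x ⟧ ≡ ⟦ y ⟧
  ⟦+⟧-cancelˡ zero    e = e
  ⟦+⟧-cancelˡ (suc c) {x} {y} e = ⟦+⟧-cancelˡ c (begin
    ⟦ c + x ⟧              ≡⟨ ⟦+m⟧ (c + x) ⟨
    ⟦ c + x + m ⟧          ≡⟨ cong ⟦_⟧ (shift (c + x)) ⟩
    ⟦ pred m + suc (c + x) ⟧ ≡⟨ ⟦+⟧-congˡ (pred m) e ⟩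
    ⟦ pred m + suc (c + y) ⟧ ≡⟨ cong ⟦_⟧ (shift (c + y)) ⟨
    ⟦ c + y + m ⟧          ≡⟨ ⟦+m⟧ (c + y) ⟩
    ⟦ c + y ⟧              ∎)
    where
      open ≡-Reasoning
      shift : ∀ z → z + m ≡ pred m + suc z
      shift z = trans (+-comm z m) (trans (cong (_+ z) (sym (suc-pred m))) (sym (+-suc (pred m) z)))

  ⟦+⟧≢ : ∀ x {d} → 0 < d → d < m → ⟦ x + d ⟧ ≢ ⟦ x ⟧
  ⟦+⟧≢ x {d} 0<d d<m e = <⇒≢ 0<d (sym (begin
    d        ≡⟨ m<n⇒m%n≡m d<m ⟨
    d % m    ≡⟨ ⟦⟧≡⇒%≡ (⟦+⟧-cancelˡ x (trans e (cong ⟦_⟧ (sym (+-identityʳ x))))) ⟩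
    0 % m    ≡⟨ m<n⇒m%n≡m (≤-<-trans z≤n d<m) ⟩
    0        ∎))
    where open ≡-Reasoning

  ⟦⟧-injective-≤ : ∀ {x y} → x ≤ y → y ∸ x < m → ⟦ x ⟧ ≡ ⟦ y ⟧ → x ≡ y
  ⟦⟧-injective-≤ {x} {y} x≤y d<m e with y ∸ x | m+[n∸m]≡n x≤y
  ... | zero  | x+0≡y = trans (sym (+-identityʳ x)) x+0≡y
  ... | suc d | x+d≡y = ⊥-elim (⟦+⟧≢ x (s≤s z≤n) d<m (trans (cong ⟦_⟧ x+d≡y) (sym e)))

  ⟦⟧-injective-within : ∀ {x y} → ∣ x - y ∣ < m → ⟦ x ⟧ ≡ ⟦ y ⟧ → x ≡ y
  ⟦⟧-injective-within {x} {y} d<m e with ≤-total x y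
  ... | inj₁ x≤y = ⟦⟧-injective-≤ x≤y (subst (_< m) (m≤n⇒∣m-n∣≡n∸m x≤y) d<m) e
  ... | inj₂ y≤x = sym (⟦⟧-injective-≤ y≤x (subst (_< m) (m≤n⇒∣n-m∣≡n∸m y≤x) d<m) (sym e))

  ⟦+d*m⟧ : ∀ x d → ⟦ x + d * m ⟧ ≡ ⟦ x ⟧
  ⟦+d*m⟧ x d = %≡⇒⟦⟧≡ ([m+kn]%n≡m%n x d m)

  toℕ-⟦suc⟧ : ∀ x → toℕ ⟦ suc x ⟧ ≡ suc (toℕ ⟦ x ⟧) % m
  toℕ-⟦suc⟧ x = begin
    toℕ ⟦ suc x ⟧         ≡⟨ cong toℕ (⟦suc⟧-cong (⟦%⟧ x)) ⟨
    toℕ ⟦ suc (x % m) ⟧   ≡⟨ toℕ-⟦⟧ (suc (x % m)) ⟩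
    suc (x % m) % m       ≡⟨ cong (λ z → suc z % m) (toℕ-⟦⟧ x) ⟨
    suc (toℕ ⟦ x ⟧) % m   ∎
    where open ≡-Reasoning

  ⟦suc⟧≢ : 2 ≤ m → ∀ i → ⟦ suc (toℕ i) ⟧ ≢ i
  ⟦suc⟧≢ 2≤m i e = ⟦+⟧≢ (toℕ i) {1} (s≤s z≤n) 2≤m
    (trans (cong ⟦_⟧ (+-comm (toℕ i) 1)) (trans e (sym (⟦toℕ⟧ i))))

  ⟦suc⟧-asym : 3 ≤ m → ∀ i j → j ≡ ⟦ suc (toℕ i) ⟧ → i ≢ ⟦ suc (toℕ j) ⟧
  ⟦suc⟧-asym 3≤m i j refl e = ⟦+⟧≢ (toℕ i) {2} (s≤s z≤n) 3≤m (begin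
    ⟦ toℕ i + 2 ⟧                   ≡⟨ cong ⟦_⟧ (+-comm (toℕ i) 2) ⟩
    ⟦ suc (suc (toℕ i)) ⟧           ≡⟨ ⟦suc⟧-cong (⟦toℕ⟧ ⟦ suc (toℕ i) ⟧) ⟨
    ⟦ suc (toℕ ⟦ suc (toℕ i) ⟧) ⟧   ≡⟨ e ⟨
    i                               ≡⟨ ⟦toℕ⟧ i ⟨
    ⟦ toℕ i ⟧                       ∎)
    where open ≡-Reasoning

  CycAdj-⟦suc⟧ : ∀ x → CycAdj m ⟦ x ⟧ ⟦ suc x ⟧
  CycAdj-⟦suc⟧ x with suc (toℕ ⟦ x ⟧) <? m
  ... | yes lt = inj₁ (sym (trans (toℕ-⟦suc⟧ x) (m<n⇒m%n≡m lt)))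
  ... | no ge = inj₂ (wraps , trans (toℕ-⟦suc⟧ x) (trans (cong (_% m) wraps) (n%n≡0 m)))
    where
      wraps : suc (toℕ ⟦ x ⟧) ≡ m
      wraps = ≤-antisym (toℕ<n ⟦ x ⟧) (≮⇒≥ ge)

  CycAdj⇒≡⟦suc⟧ : ∀ {i j} → CycAdj m i j → j ≡ ⟦ suc (toℕ i) ⟧
  CycAdj⇒≡⟦suc⟧ {i} {j} (inj₁ e) = trans (sym (⟦toℕ⟧ j)) (cong ⟦_⟧ (sym e))
  CycAdj⇒≡⟦suc⟧ {i} {j} (inj₂ (e , j≡0)) = begin
    j               ≡⟨ ⟦toℕ⟧ j ⟨
    ⟦ toℕ j ⟧       ≡⟨ cong ⟦_⟧ j≡0 ⟩
    ⟦ 0 ⟧           ≡⟨ ⟦+m⟧ 0 ⟨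
    ⟦ m ⟧           ≡⟨ cong ⟦_⟧ e ⟨
    ⟦ suc (toℕ i) ⟧ ∎
    where open ≡-Reasoning

-- Local coordinates and slices

Local : Set
Local = ℕ × Layer

data Step : Set where
  rung right left : Step

move : Step → Local → Local
move rung  (p , a) = p , opposite a
move right (p , a) = suc p , a
move left  (p , a) = pred p , a

-- move left truncates at column 0 (pred 0 = 0), where it is not a step of the prism.
Admissible : Step → ℕ → Set
Admissible left p = 1 ≤ p
Admissible _    _ = ⊤

-- The colours of the rung at column x and of the top and bottom edges from column x to x + 1.
Slice : ℕ → Set
Slice k = Fin k × Fin k × Fin k

_‼_ : ∀ {k} → Slice k → Fin 3 → Fin k
(r , _ , _) ‼ zero           = r
(_ , t , _) ‼ suc zero       = t
(_ , _ , b) ‼ suc (suc zero) = b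

column : Step → ℕ → ℕ
column left p = pred p
column _    p = p

kind : Step → Layer → Fin 3
kind rung _ = zero
kind _    a = suc a

stepColour : ∀ {k} → (ℕ → Slice k) → Step → Local → Fin k
stepColour w s (p , a) = w (column s p) ‼ kind s a

window : ∀ {A : Set} → (ℕ → A) → ℕ → ℕ → A
window S b j = S (b + j)

module _ {m : ℕ} .{{_ : NonZero m}} where
  open Cyclic m

  chart : ℕ → Local → V (Prism m)
  chart b (p , a) = ⟦ b + p ⟧ , a

  horizontal : ∀ {k} → EdgeColouring (Prism m) k → Layer → ℕ → Fin k
  horizontal C a x = col C (⟦ x ⟧ , a) (⟦ suc x ⟧ , a)

  slices : ∀ {k} → EdgeColouring (Prism m) k → ℕ → Slice k
  slices C x = col C (⟦ x ⟧ , zero) (⟦ x ⟧ , suc zero) , horizontal C zero x , horizontal C (suc zero) x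

  slices-cong : ∀ {k} (C : EdgeColouring (Prism m) k) {x y} → ⟦ x ⟧ ≡ ⟦ y ⟧ → slices C x ≡ slices C y
  slices-cong C e = cong₂ (λ i j → col C (i , zero) (i , suc zero) , col C (i , zero) (j , zero) , col C (i , suc zero) (j , suc zero))
                          e (⟦suc⟧-cong e)

  horizontal-cong : ∀ {k} (C : EdgeColouring (Prism m) k) a {x y} → ⟦ x ⟧ ≡ ⟦ y ⟧ → horizontal C a x ≡ horizontal C a y
  horizontal-cong C a e = cong₂ (λ i j → col C (i , a) (j , a)) e (⟦suc⟧-cong e)

  slices‼suc : ∀ {k} (C : EdgeColouring (Prism m) k) x a → slices C x ‼ suc a ≡ horizontal C a x
  slices‼suc C x zero       = refl
  slices‼suc C x (suc zero) = refl

  horizontal-Adj : ∀ x a → Adj (Prism m) (⟦ x ⟧ , a) (⟦ suc x ⟧ , a)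
  horizontal-Adj x a = inj₁ (inj₁ (CycAdj-⟦suc⟧ x) , refl)

  rung-Adj : ∀ i a → Adj (Prism m) (i , a) (i , opposite a)
  rung-Adj i zero       = inj₂ (refl , inj₁ refl)
  rung-Adj i (suc zero) = inj₂ (refl , inj₂ refl)

  step-Adj : ∀ b s l → Admissible s (proj₁ l) → Adj (Prism m) (chart b l) (chart b (move s l))
  step-Adj b rung  (p , a)     _ = rung-Adj ⟦ b + p ⟧ a
  step-Adj b right (p , a)     _ rewrite +-suc b p = horizontal-Adj (b + p) a
  step-Adj b left  (suc p , a) _ rewrite +-suc b p = Adj-Prism-sym (horizontal-Adj (b + p) a)

  step-colour : ∀ {k} (C : EdgeColouring (Prism m) k) b s l → Admissible s (proj₁ l) →
                col C (chart b l) (chart b (move s l)) ≡ stepColour (window (slices C) b) s l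
  step-colour C b rung  (p , zero)     _ = refl
  step-colour C b rung  (p , suc zero) _ = EdgeColouring.sym C _ _ (rung-Adj ⟦ b + p ⟧ (suc zero))
  step-colour C b right (p , a)        _ rewrite +-suc b p = sym (slices‼suc C (b + p) a)
  step-colour C b left  (suc p , a)    _ rewrite +-suc b p =
    trans (EdgeColouring.sym C _ _ (Adj-Prism-sym (horizontal-Adj (b + p) a))) (sym (slices‼suc C (b + p) a))

  neighbour-step : ∀ b {l v} → 1 ≤ proj₁ l → Adj (Prism m) (chart b l) v → Σ Step λ s → chart b (move s l) ≡ v
  neighbour-step b {p , a}     _ (inj₂ (refl , ac)) = rung , cong (_ ,_) (sym (Adj-Path2⇒opposite ac))
  neighbour-step b {p , a}     _ (inj₁ (inj₁ e , refl)) =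
    right , cong (_, a) (sym (trans (CycAdj⇒≡⟦suc⟧ e) (trans (⟦suc⟧-cong (⟦toℕ⟧ ⟦ b + p ⟧)) (cong ⟦_⟧ (sym (+-suc b p))))))
  neighbour-step b {suc p , a} _ (inj₁ (inj₂ e , refl)) =
    left , cong (_, a) (trans (⟦+⟧-cancelˡ 1 (trans (cong ⟦_⟧ (sym (+-suc b p))) (CycAdj⇒≡⟦suc⟧ e))) (⟦toℕ⟧ _))

  chart-onto : ∀ p (v : V (Prism m)) → Σ ℕ λ b → chart b (p , proj₂ v) ≡ v
  chart-onto p (i , a) = toℕ i + p * pred m , cong (_, a) (begin
    ⟦ toℕ i + p * pred m + p ⟧     ≡⟨ cong ⟦_⟧ (+-assoc (toℕ i) (p * pred m) p) ⟩
    ⟦ toℕ i + (p * pred m + p) ⟧   ≡⟨ cong (λ z → ⟦ toℕ i + z ⟧) (trans (+-comm (p * pred m) p) (sym (*-suc p (pred m)))) ⟩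
    ⟦ toℕ i + p * suc (pred m) ⟧   ≡⟨ cong (λ z → ⟦ toℕ i + p * z ⟧) (suc-pred m) ⟩
    ⟦ toℕ i + p * m ⟧              ≡⟨ ⟦+d*m⟧ (toℕ i) p ⟩
    ⟦ toℕ i ⟧                      ≡⟨ ⟦toℕ⟧ i ⟩
    i                              ∎)
    where open ≡-Reasoning

  chart-apart : ∀ {b l l' u u'} → chart b l ≡ u → chart b l' ≡ u' → u ≢ u' → l ≢ l'
  chart-apart refl refl u≢u' l≡l' = u≢u' (cong (chart _) l≡l')

-- Star colourings given by slices

_≟ˡ_ : DecidableEquality Local
_≟ˡ_ = ≡-dec _≟_ _≟ᶠ_

∀-Layer? : ∀ {P : Layer → Set} → (∀ a → Dec (P a)) → Dec (∀ a → P a)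
∀-Layer? P? with P? zero | P? (suc zero)
... | yes p | yes q = yes λ { zero → p ; (suc zero) → q }
... | no ¬p | _     = no λ all → ¬p (all zero)
... | _     | no ¬q = no λ all → ¬q (all (suc zero))

∀-Step? : ∀ {P : Step → Set} → (∀ s → Dec (P s)) → Dec (∀ s → P s)
∀-Step? P? with P? rung | P? right | P? left
... | yes p | yes q | yes r = yes λ { rung → p ; right → q ; left → r }
... | no ¬p | _     | _     = no λ all → ¬p (all rung)
... | _     | no ¬q | _     = no λ all → ¬q (all right)
... | _     | _     | no ¬r = no λ all → ¬r (all left)

-- Walks of at most four steps from column 4 only use the slices of columns 0 to 7.
centre : Layer → Local
centre a = 4 , a

module _ {k : ℕ} (w : ℕ → Slice k) where

  BadPair : Layer → Step → Step → Set
  BadPair a s s' = move s (centre a) ≢ move s' (centre a)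
                 × stepColour w s (centre a) ≡ stepColour w s' (centre a)

  BadWalk : Layer → Step → Step → Step → Step → Set
  BadWalk a s₁ s₂ s₃ s₄ =
    l₀ ≢ l₁ × l₀ ≢ l₂ × l₀ ≢ l₃ × l₁ ≢ l₂ × l₁ ≢ l₃ × l₂ ≢ l₃ × l₄ ≢ l₁ × l₄ ≢ l₂ × l₄ ≢ l₃ ×
    stepColour w s₁ l₀ ≡ stepColour w s₃ l₂ × stepColour w s₂ l₁ ≡ stepColour w s₄ l₃
    where
      l₀ l₁ l₂ l₃ l₄ : Local
      l₀ = centre a
      l₁ = move s₁ l₀
      l₂ = move s₂ l₁
      l₃ = move s₃ l₂
      l₄ = move s₄ l₃

  record WindowOK : Set where
    field
      no-bad-pair : ∀ a s s' → ¬ BadPair a s s'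
      no-bad-walk : ∀ a s₁ s₂ s₃ s₄ → ¬ BadWalk a s₁ s₂ s₃ s₄

  badPair? : ∀ a s s' → Dec (BadPair a s s')
  badPair? a s s' = ¬? (move s (centre a) ≟ˡ move s' (centre a))
               ×-dec (stepColour w s (centre a) ≟ᶠ stepColour w s' (centre a))

  badWalk? : ∀ a s₁ s₂ s₃ s₄ → Dec (BadWalk a s₁ s₂ s₃ s₄)
  badWalk? a s₁ s₂ s₃ s₄ =
    ¬? (l₀ ≟ˡ l₁) ×-dec ¬? (l₀ ≟ˡ l₂) ×-dec ¬? (l₀ ≟ˡ l₃) ×-dec ¬? (l₁ ≟ˡ l₂) ×-dec ¬? (l₁ ≟ˡ l₃)
    ×-dec ¬? (l₂ ≟ˡ l₃) ×-dec ¬? (l₄ ≟ˡ l₁) ×-dec ¬? (l₄ ≟ˡ l₂) ×-dec ¬? (l₄ ≟ˡ l₃)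
    ×-dec (stepColour w s₁ l₀ ≟ᶠ stepColour w s₃ l₂) ×-dec (stepColour w s₂ l₁ ≟ᶠ stepColour w s₄ l₃)
    where
      l₀ l₁ l₂ l₃ l₄ : Local
      l₀ = centre a
      l₁ = move s₁ l₀
      l₂ = move s₂ l₁
      l₃ = move s₃ l₂
      l₄ = move s₄ l₃

  windowOK? : Dec WindowOK
  windowOK? = map′ (λ (p , q) → record { no-bad-pair = p ; no-bad-walk = q })
                   (λ ok → WindowOK.no-bad-pair ok , WindowOK.no-bad-walk ok)
    (∀-Layer? (λ a → ∀-Step? λ s → ∀-Step? λ s' → ¬? (badPair? a s s'))
     ×-dec ∀-Layer? (λ a → ∀-Step? λ s₁ → ∀-Step? λ s₂ → ∀-Step? λ s₃ → ∀-Step? λ s₄ → ¬? (badWalk? a s₁ s₂ s₃ s₄)))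

record Near (r : ℕ) (l : Local) : Set where
  constructor near
  field
    lower : 4 ∸ r ≤ proj₁ l
    upper : proj₁ l ≤ 4 + r

near-centre : ∀ a → Near 0 (centre a)
near-centre a = near ≤-refl ≤-refl

near-move : ∀ {r} s l → Near r l → Near (suc r) (move s l)
near-move {r} rung  (p , a) (near lo hi) = near (≤-trans (∸-monoʳ-≤ 4 (n≤1+n r)) lo) (≤-trans hi (+-monoʳ-≤ 4 (n≤1+n r)))
near-move {r} right (p , a) (near lo hi) = near (≤-trans (∸-monoʳ-≤ 4 (n≤1+n r)) (≤-trans lo (n≤1+n p))) (s≤s hi)
near-move {r} left  (p , a) (near lo hi) =
  near (subst (_≤ pred p) (pred[m∸n]≡m∸[1+n] 4 r) (pred-mono-≤ lo)) (≤-trans pred[n]≤n (≤-trans hi (+-monoʳ-≤ 4 (n≤1+n r))))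

near⇒1≤ : ∀ {r l} → r < 4 → Near r l → 1 ≤ proj₁ l
near⇒1≤ r<4 (near lo _) = ≤-trans (m<n⇒0<n∸m r<4) lo

near⇒column<8 : ∀ {r l} s → r < 4 → Near r l → column s (proj₁ l) < 8
near⇒column<8 {l = p , _} s r<4 (near _ hi) = ≤-<-trans (column≤ s) (≤-<-trans hi (+-monoʳ-< 4 r<4))
  where
    column≤ : ∀ s → column s p ≤ p
    column≤ rung  = ≤-refl
    column≤ right = ≤-refl
    column≤ left  = pred[n]≤n

admissible : ∀ s {p} → 1 ≤ p → Admissible s p
admissible rung  _ = _
admissible right _ = _
admissible left  h = h

module SliceColouring {m : ℕ} .{{_ : NonZero m}} (3≤m : 3 ≤ m) {k : ℕ} (S : ℕ → Slice k) where
  open Cyclic m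

  2≤m : 2 ≤ m
  2≤m = ≤-trans (n≤1+n 2) 3≤m

  sliceColour : V (Prism m) → V (Prism m) → Fin k
  sliceColour (i , a) (j , _) with i ≟ᶠ j | j ≟ᶠ ⟦ suc (toℕ i) ⟧
  ... | yes _ | _     = S (toℕ i) ‼ zero
  ... | no _  | yes _ = S (toℕ i) ‼ suc a
  ... | no _  | no _  = S (toℕ j) ‼ suc a

  sliceColour-rung : ∀ i a b → sliceColour (i , a) (i , b) ≡ S (toℕ i) ‼ zero
  sliceColour-rung i a b with i ≟ᶠ i | i ≟ᶠ ⟦ suc (toℕ i) ⟧
  ... | yes _  | _ = refl
  ... | no i≢i | _ = ⊥-elim (i≢i refl)

  sliceColour-forward : ∀ {i j} a b → j ≡ ⟦ suc (toℕ i) ⟧ → sliceColour (i , a) (j , b) ≡ S (toℕ i) ‼ suc a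
  sliceColour-forward {i} {j} a b e with i ≟ᶠ j | j ≟ᶠ ⟦ suc (toℕ i) ⟧
  ... | yes i≡j | _     = ⊥-elim (⟦suc⟧≢ 2≤m i (trans (sym e) (sym i≡j)))
  ... | no _    | yes _ = refl
  ... | no _    | no ¬e = ⊥-elim (¬e e)

  sliceColour-backward : ∀ {i j} a b → i ≡ ⟦ suc (toℕ j) ⟧ → sliceColour (i , a) (j , b) ≡ S (toℕ j) ‼ suc a
  sliceColour-backward {i} {j} a b e with i ≟ᶠ j | j ≟ᶠ ⟦ suc (toℕ i) ⟧
  ... | yes i≡j | _     = ⊥-elim (⟦suc⟧≢ 2≤m j (trans (sym e) i≡j))
  ... | no _    | yes f = ⊥-elim (⟦suc⟧-asym 3≤m i j f e)
  ... | no _    | no _  = refl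

  sliceColour-sym : ∀ u v → Adj (Prism m) u v → sliceColour u v ≡ sliceColour v u
  sliceColour-sym (i , a) (.i , b) (inj₂ (refl , _)) = trans (sliceColour-rung i a b) (sym (sliceColour-rung i b a))
  sliceColour-sym (i , a) (j , .a) (inj₁ (inj₁ c , refl)) =
    trans (sliceColour-forward a a (CycAdj⇒≡⟦suc⟧ c)) (sym (sliceColour-backward a a (CycAdj⇒≡⟦suc⟧ c)))
  sliceColour-sym (i , a) (j , .a) (inj₁ (inj₂ c , refl)) =
    trans (sliceColour-backward a a (CycAdj⇒≡⟦suc⟧ c)) (sym (sliceColour-forward a a (CycAdj⇒≡⟦suc⟧ c)))

  colouring : EdgeColouring (Prism m) k
  colouring = record { col = sliceColour ; sym = sliceColour-sym }

  module _ (periodic : ∀ x → S (x % m) ≡ S x) where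

    slices-colouring : ∀ x → slices colouring x ≡ S x
    slices-colouring x = trans (cong₂ _,_ (sliceColour-rung ⟦ x ⟧ zero (suc zero)) (cong₂ _,_ (forward zero) (forward (suc zero))))
                               (trans (cong S (toℕ-⟦⟧ x)) (periodic x))
      where
        forward : ∀ a → horizontal colouring a x ≡ S (toℕ ⟦ x ⟧) ‼ suc a
        forward a = sliceColour-forward a a (⟦suc⟧-cong (sym (⟦toℕ⟧ ⟦ x ⟧)))

    module _ {b : ℕ} {w : ℕ → Slice k} (agree : ∀ j → j < 8 → w j ≡ S (b + j)) where

      lift : ∀ {r l u v} → r < 4 → Near r l → chart b l ≡ u → Adj (Prism m) u v →
             Σ Step λ s → Near (suc r) (move s l) × chart b (move s l) ≡ v × col colouring u v ≡ stepColour w s l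
      lift {r} {p , a} r<4 h refl uv with neighbour-step b (near⇒1≤ r<4 h) uv
      ... | s , refl = s , near-move s (p , a) h , refl , (begin
        col colouring (chart b (p , a)) (chart b (move s (p , a)))
          ≡⟨ step-colour colouring b s (p , a) (admissible s (near⇒1≤ r<4 h)) ⟩
        slices colouring (b + column s p) ‼ kind s a
          ≡⟨ cong (_‼ kind s a) (slices-colouring (b + column s p)) ⟩
        S (b + column s p) ‼ kind s a
          ≡⟨ cong (_‼ kind s a) (agree (column s p) (near⇒column<8 s r<4 h)) ⟨
        w (column s p) ‼ kind s a ∎)
        where open ≡-Reasoning

    Windows : Set
    Windows = ∀ b → Σ (ℕ → Slice k) λ w → WindowOK w × (∀ j → j < 8 → w j ≡ S (b + j))

    colouring-star : Windows → StarEdgeColouring (Prism m) k colouring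
    colouring-star windows = proper , noBichromatic
      where
        proper : Proper colouring
        proper u v x uv vx u≢x same with chart-onto 4 v
        ... | b , e with windows b
        ... | w , ok , agree with lift agree z<s (near-centre _) e (Adj-Prism-sym uv) | lift agree z<s (near-centre _) e vx
        ... | s , _ , eu , cu | s' , _ , ex , cx =
          WindowOK.no-bad-pair ok (proj₂ v) s s'
            (chart-apart eu ex u≢x , trans (sym cu) (trans (sym (sliceColour-sym u v uv)) (trans same cx)))

        noBichromatic : NoBichromatic4 colouring
        noBichromatic v₀ v₁ v₂ v₃ v₄ a₀₁ a₁₂ a₂₃ a₃₄ n₀₁ n₀₂ n₀₃ n₁₂ n₁₃ n₂₃ n₄₁ n₄₂ n₄₃ (c₀₂ , c₁₃)
          with chart-onto 4 v₀
        ... | b , e₀ with windows b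
        ... | w , ok , agree with lift agree z<s (near-centre _) e₀ a₀₁
        ... | s₁ , h₁ , e₁ , k₁ with lift agree (s<s z<s) h₁ e₁ a₁₂
        ... | s₂ , h₂ , e₂ , k₂ with lift agree (s<s (s<s z<s)) h₂ e₂ a₂₃
        ... | s₃ , h₃ , e₃ , k₃ with lift agree (s<s (s<s (s<s z<s))) h₃ e₃ a₃₄
        ... | s₄ , _  , e₄ , k₄ =
          WindowOK.no-bad-walk ok (proj₂ v₀) s₁ s₂ s₃ s₄
            ( chart-apart e₀ e₁ n₀₁ , chart-apart e₀ e₂ n₀₂ , chart-apart e₀ e₃ n₀₃
            , chart-apart e₁ e₂ n₁₂ , chart-apart e₁ e₃ n₁₃ , chart-apart e₂ e₃ n₂₃
            , chart-apart e₄ e₁ n₄₁ , chart-apart e₄ e₂ n₄₂ , chart-apart e₄ e₃ n₄₃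
            , trans (sym k₁) (trans c₀₂ k₃) , trans (sym k₂) (trans c₁₃ k₄))

-- Colourings given by cyclic words

nth : ∀ {A : Set} → A → List A → ℕ → A
nth d []       _       = d
nth d (x ∷ _)  zero    = x
nth d (_ ∷ xs) (suc i) = nth d xs i

copies : ∀ {A : Set} → ℕ → List A → List A
copies zero    _  = []
copies (suc c) xs = xs ++ copies c xs

length-copies : ∀ {A : Set} c (xs : List A) → length (copies c xs) ≡ c * length xs
length-copies zero    xs = refl
length-copies (suc c) xs = trans (length-++ xs) (cong (length xs +_) (length-copies c xs))

drop-copies : ∀ {A : Set} t c (xs : List A) {r} ys → t ≤ c →
              drop (t * length xs + r) (copies c xs ++ ys) ≡ drop r (copies (c ∸ t) xs ++ ys)
drop-copies zero    c       xs ys _ = refl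
drop-copies (suc t) (suc c) xs {r} ys (s≤s t≤c) = begin
  drop ((length xs + t * length xs) + r) ((xs ++ copies c xs) ++ ys)
    ≡⟨ cong₂ drop (+-assoc (length xs) _ r) (++-assoc xs (copies c xs) ys) ⟩
  drop (length xs + (t * length xs + r)) (xs ++ (copies c xs ++ ys))
    ≡⟨ drop-length-++ xs {t * length xs + r} ⟩
  drop (t * length xs + r) (copies c xs ++ ys)
    ≡⟨ drop-copies t c xs ys t≤c ⟩
  drop r (copies (c ∸ t) xs ++ ys) ∎
  where
    open ≡-Reasoning
    drop-length-++ : ∀ us {n zs} → drop (length us + n) (us ++ zs) ≡ drop n zs
    drop-length-++ []       = refl
    drop-length-++ (u ∷ us) = drop-length-++ us

module _ {A : Set} (d : A) where

  nth-drop : ∀ r xs j → nth d (drop r xs) j ≡ nth d xs (r + j)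
  nth-drop zero    xs       j = refl
  nth-drop (suc r) []       j = refl
  nth-drop (suc r) (x ∷ xs) j = nth-drop r xs j

  nth-++ˡ : ∀ xs ys {i} → i < length xs → nth d (xs ++ ys) i ≡ nth d xs i
  nth-++ˡ (x ∷ xs) ys {zero}  _         = refl
  nth-++ˡ (x ∷ xs) ys {suc i} (s≤s i<n) = nth-++ˡ xs ys i<n

  nth-++ʳ : ∀ xs ys i → nth d (xs ++ ys) (length xs + i) ≡ nth d ys i
  nth-++ʳ []       ys i = refl
  nth-++ʳ (x ∷ xs) ys i = nth-++ʳ xs ys i

  nth-copies : ∀ xs .{{_ : NonZero (length xs)}} c {y} → y < c * length xs →
               nth d (copies c xs) y ≡ nth d xs (y % length xs)
  nth-copies xs (suc c) {y} y< with y <? length xs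
  ... | yes y<n = trans (nth-++ˡ xs _ y<n) (cong (nth d xs) (sym (m<n⇒m%n≡m y<n)))
  ... | no  y≮n = begin
    nth d (xs ++ copies c xs) y                ≡⟨ cong (nth d (xs ++ copies c xs)) y≡ ⟨
    nth d (xs ++ copies c xs) (length xs + y′) ≡⟨ nth-++ʳ xs _ y′ ⟩
    nth d (copies c xs) y′                     ≡⟨ nth-copies xs c (+-cancelˡ-< (length xs) y′ _ (subst (_< _) (sym y≡) y<)) ⟩
    nth d xs (y′ % length xs)                  ≡⟨ cong (nth d xs) (trans (sym ([m+n]%n≡m%n y′ (length xs))) (cong (_% length xs) (trans (+-comm y′ _) y≡))) ⟩
    nth d xs (y % length xs)                   ∎
    where
      open ≡-Reasoning
      y′ : ℕ
      y′ = y ∸ length xs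
      y≡ : length xs + y′ ≡ y
      y≡ = m+[n∸m]≡n (≮⇒≥ y≮n)

module _ {k : ℕ} (pad : Slice k) where

  -- pad is only a junk value past the end of a list: the windows below never reach it.
  AllWindowsOK : List (Slice k) → ℕ → Set
  AllWindowsOK xs n = ∀ {r} → r < n → WindowOK (nth pad (drop r xs))

  allWindowsOK? : ∀ xs n → Dec (AllWindowsOK xs n)
  allWindowsOK? xs = allUpTo? (λ r → windowOK? (nth pad (drop r xs)))

  word-star : ∀ xs → 3 ≤ length xs → AllWindowsOK (copies 4 xs) (length xs) → StarColourable (Prism (length xs)) k
  word-star xs 3≤m ok = colouring , colouring-star periodic windows
    where
      m : ℕ
      m = length xs
      instance
        m≢0 : NonZero m
        m≢0 = >-nonZero (≤-trans (s≤s z≤n) 3≤m)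
      S : ℕ → Slice k
      S x = nth pad xs (x % m)
      open SliceColouring 3≤m S
      periodic : ∀ x → S (x % m) ≡ S x
      periodic x = cong (nth pad xs) (m%n%n≡m%n x m)
      windows : Windows periodic
      windows b = nth pad (drop (b % m) (copies 4 xs)) , ok (m%n<n b m) , agree
        where
          agree : ∀ j → j < 8 → nth pad (drop (b % m) (copies 4 xs)) j ≡ S (b + j)
          agree j j<8 = begin
            nth pad (drop (b % m) (copies 4 xs)) j  ≡⟨ nth-drop pad (b % m) (copies 4 xs) j ⟩
            nth pad (copies 4 xs) (b % m + j)       ≡⟨ nth-copies pad xs 4 (+-mono-<-≤ (m%n<n b m) (≤-trans (<⇒≤ j<8) (≤-trans (n≤1+n 8) (*-monoʳ-≤ 3 3≤m)))) ⟩
            nth pad xs ((b % m + j) % m)            ≡⟨ cong (nth pad xs) (begin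
              (b % m + j) % m         ≡⟨ %-distribˡ-+ (b % m) j m ⟩
              (b % m % m + j % m) % m ≡⟨ cong (λ z → (z + j % m) % m) (m%n%n≡m%n b m) ⟩
              (b % m + j % m) % m     ≡⟨ %-distribˡ-+ b j m ⟨
              (b + j) % m             ∎) ⟩
            S (b + j)                                 ∎
            where open ≡-Reasoning

  module Family (P Y : List (Slice k)) .{{_ : NonZero (length P)}} where

    familyWord : ℕ → List (Slice k)
    familyWord q = copies (2 + q) P ++ Y

    private
      ℓ : ℕ
      ℓ = length P
      X₀ L : ℕ → List (Slice k)
      X₀ q = copies q P ++ Y ++ copies 2 (familyWord q)
      L q = Y ++ P ++ P ++ X₀ q

    copies-++ : ∀ s R → copies (suc s) P ++ R ≡ P ++ (copies s P ++ R)
    copies-++ s R = ++-assoc P (copies s P) R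

    unrolled : ∀ q → copies 4 (familyWord q) ≡ copies (2 + q) P ++ L q
    unrolled q = begin
      (copies (2 + q) P ++ Y) ++ copies 3 w      ≡⟨ ++-assoc (copies (2 + q) P) Y _ ⟩
      copies (2 + q) P ++ Y ++ copies 3 w        ≡⟨ cong (λ zs → copies (2 + q) P ++ Y ++ zs) (begin
        (copies (2 + q) P ++ Y) ++ copies 2 w    ≡⟨ ++-assoc (copies (2 + q) P) Y _ ⟩
        copies (2 + q) P ++ Y ++ copies 2 w      ≡⟨ copies-++ (suc q) _ ⟩
        P ++ copies (1 + q) P ++ Y ++ copies 2 w ≡⟨ cong (P ++_) (copies-++ q _) ⟩
        P ++ P ++ copies q P ++ Y ++ copies 2 w  ∎) ⟩
      copies (2 + q) P ++ Y ++ P ++ P ++ (copies q P ++ Y ++ copies 2 w) ∎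
      where
        open ≡-Reasoning
        w : List (Slice k)
        w = familyWord q

    -- Every window of the cyclic word P^(q+2) Y begins inside one of these four words, whatever X is.
    module _ (ppp : ∀ X → AllWindowsOK (P ++ P ++ P ++ X) (length P))
             (ppy : ∀ X → AllWindowsOK (P ++ P ++ Y ++ P ++ P ++ X) (length P))
             (py  : ∀ X → AllWindowsOK (P ++ Y ++ P ++ P ++ X) (length P))
             (y   : ∀ X → AllWindowsOK (Y ++ P ++ P ++ X) (length Y)) where

      blocks : ∀ X s → AllWindowsOK (copies (suc s) P ++ Y ++ P ++ P ++ X) (length P)
      blocks X zero          = subst (λ zs → AllWindowsOK zs (length P)) (sym (copies-++ 0 _)) (py X)
      blocks X (suc zero)    = subst (λ zs → AllWindowsOK zs (length P))
        (sym (trans (copies-++ 1 _) (cong (P ++_) (copies-++ 0 _)))) (ppy X)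
      blocks X (suc (suc t)) = subst (λ zs → AllWindowsOK zs (length P))
        (sym (trans (copies-++ (2 + t) _) (cong (P ++_) (trans (copies-++ (1 + t) _) (cong (P ++_) (copies-++ t _))))))
        (ppp (copies t P ++ Y ++ P ++ P ++ X))

      family-windows : ∀ q → AllWindowsOK (copies 4 (familyWord q)) (length (familyWord q))
      family-windows q {r} r<|w| with r <? (2 + q) * ℓ
      ... | yes r<blocks = subst (λ zs → WindowOK (nth pad zs)) (sym (begin
        drop r (copies 4 (familyWord q))                      ≡⟨ cong₂ drop r≡ (unrolled q) ⟩
        drop (t * ℓ + r % ℓ) (copies (2 + q) P ++ L q)        ≡⟨ drop-copies t (2 + q) P (L q) (<⇒≤ t<) ⟩
        drop (r % ℓ) (copies ((2 + q) ∸ t) P ++ L q)          ≡⟨ cong (λ c → drop (r % ℓ) (copies c P ++ L q)) (+-∸-assoc 1 (s≤s⁻¹ t<)) ⟩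
        drop (r % ℓ) (copies (suc ((1 + q) ∸ t)) P ++ L q)    ∎))
        (blocks (X₀ q) ((1 + q) ∸ t) (m%n<n r ℓ))
        where
          open ≡-Reasoning
          t : ℕ
          t = r / ℓ
          t< : t < 2 + q
          t< = m<n*o⇒m/o<n r<blocks
          r≡ : r ≡ t * ℓ + r % ℓ
          r≡ = trans (m≡m%n+[m/n]*n r ℓ) (+-comm (r % ℓ) (t * ℓ))
      ... | no r≮blocks = subst (λ zs → WindowOK (nth pad zs)) (sym (begin
        drop r (copies 4 (familyWord q))                      ≡⟨ cong₂ drop (sym r≡) (unrolled q) ⟩
        drop ((2 + q) * ℓ + y′) (copies (2 + q) P ++ L q)     ≡⟨ drop-copies (2 + q) (2 + q) P (L q) ≤-refl ⟩
        drop y′ (copies ((2 + q) ∸ (2 + q)) P ++ L q)         ≡⟨ cong (λ c → drop y′ (copies c P ++ L q)) (n∸n≡0 (2 + q)) ⟩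
        drop y′ (L q)                                         ∎))
        (y (X₀ q) (+-cancelˡ-< ((2 + q) * ℓ) y′ (length Y) (subst₂ _<_ (sym r≡) |w|≡ r<|w|)))
        where
          open ≡-Reasoning
          y′ : ℕ
          y′ = r ∸ (2 + q) * ℓ
          r≡ : (2 + q) * ℓ + y′ ≡ r
          r≡ = m+[n∸m]≡n (≮⇒≥ r≮blocks)
          |w|≡ : length (familyWord q) ≡ (2 + q) * ℓ + length Y
          |w|≡ = trans (length-++ (copies (2 + q) P)) (cong (_+ length Y) (length-copies (2 + q) P))

block : ∀ {k} → List (Slice (4 + k))
block = (# 0 , # 1 , # 2) ∷ (# 3 , # 0 , # 1) ∷ (# 2 , # 3 , # 0) ∷ (# 1 , # 2 , # 3) ∷ []

tail₁ tail₂ tail₃ : List (Slice 5)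
tail₁ = (# 0 , # 1 , # 2) ∷ (# 3 , # 0 , # 1) ∷ (# 2 , # 3 , # 4) ∷ (# 1 , # 2 , # 0) ∷ (# 1 , # 4 , # 3) ∷ []
tail₂ = (# 0 , # 1 , # 2) ∷ (# 3 , # 4 , # 4) ∷ []
tail₃ = (# 4 , # 0 , # 0) ∷ (# 1 , # 2 , # 2) ∷ (# 3 , # 4 , # 4) ∷ []

triangle : List (Slice 6)
triangle = (# 0 , # 1 , # 1) ∷ (# 2 , # 3 , # 3) ∷ (# 0 , # 4 , # 5) ∷ []

blank : ∀ {k} → Slice (suc k)
blank = zero , zero , zero

windows-by-decision : ∀ {k} xs n {_ : True (allWindowsOK? (blank {k}) xs n)} → AllWindowsOK blank xs n
windows-by-decision xs n {ok} = toWitness ok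

word-star-by-decision : ∀ {k} (xs : List (Slice (suc k))) {_ : True (3 ≤? length xs)}
                    {_ : True (allWindowsOK? blank (copies 4 xs) (length xs))} → StarColourable (Prism (length xs)) (suc k)
word-star-by-decision xs {3≤m} {ok} = word-star blank xs (toWitness 3≤m) (toWitness ok)

module _ {k} (Y : List (Slice (4 + k)))
         (ppy : ∀ X → AllWindowsOK blank (block ++ block ++ Y ++ block ++ block ++ X) 4)
         (py  : ∀ X → AllWindowsOK blank (block ++ Y ++ block ++ block ++ X) 4)
         (y   : ∀ X → AllWindowsOK blank (Y ++ block ++ block ++ X) (length Y)) where
  open Family blank block Y

  family-star : ∀ q → StarColourable (Prism (length Y + (2 + q) * 4)) (4 + k)
  family-star q = subst (λ n → StarColourable (Prism n) (4 + k)) |w|≡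
    (word-star blank (familyWord q) (s≤s (s≤s (s≤s z≤n))) (family-windows ppp ppy py y q))
    where
      ppp : ∀ X → AllWindowsOK blank (block ++ block ++ block ++ X) 4
      ppp X = windows-by-decision (block ++ block ++ block ++ X) 4
      |w|≡ : length (familyWord q) ≡ length Y + (2 + q) * 4
      |w|≡ = trans (length-++ (copies (2 + q) block)) (trans (cong (_+ length Y) (length-copies (2 + q) block)) (+-comm _ (length Y)))

starColourable₄ : ∀ m → 3 ≤ m → m % 4 ≡ 0 → StarColourable (Prism m) 4
starColourable₄ m 3≤m m%4≡0 = subst (λ n → StarColourable (Prism n) 4) (sym m≡) (by-quotient (m / 4) (subst (3 ≤_) m≡ 3≤m))
  where
    m≡ : m ≡ m / 4 * 4
    m≡ = trans (m≡m%n+[m/n]*n m 4) (cong (_+ m / 4 * 4) m%4≡0)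
    by-quotient : ∀ c → 3 ≤ c * 4 → StarColourable (Prism (c * 4)) 4
    by-quotient 1             _ = word-star-by-decision block
    by-quotient (suc (suc q)) _ = family-star []
      (λ X → windows-by-decision (block ++ block ++ block ++ block ++ X) 4)
      (λ X → windows-by-decision (block ++ block ++ block ++ X) 4)
      (λ X → windows-by-decision (block ++ block ++ X) 0) q

starColourable₅ : ∀ m → 5 ≤ m → m % 4 ≢ 0 → StarColourable (Prism m) 5
starColourable₅ m 5≤m m%4≢0 = subst (λ n → StarColourable (Prism n) 5) (sym m≡)
  (by-residue (m % 4) (m / 4) (m%n<n m 4) m%4≢0 (subst (5 ≤_) m≡ 5≤m))
  where
    m≡ : m ≡ m % 4 + m / 4 * 4
    m≡ = m≡m%n+[m/n]*n m 4
    by-residue : ∀ r c → r < 4 → r ≢ 0 → 5 ≤ r + c * 4 → StarColourable (Prism (r + c * 4)) 5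
    by-residue 0 _ _ r≢0 _ = ⊥-elim (r≢0 refl)
    by-residue 1 0 _ _ (s≤s ())
    by-residue 1 1 _ _ _ = word-star-by-decision tail₁
    by-residue 1 2 _ _ _ = word-star-by-decision (block ++ tail₁)
    by-residue 1 (suc (suc (suc q))) _ _ _ = family-star tail₁
      (λ X → windows-by-decision (block ++ block ++ tail₁ ++ block ++ block ++ X) 4)
      (λ X → windows-by-decision (block ++ tail₁ ++ block ++ block ++ X) 4)
      (λ X → windows-by-decision (tail₁ ++ block ++ block ++ X) 5) q
    by-residue 2 0 _ _ (s≤s (s≤s ()))
    by-residue 2 1 _ _ _ = word-star-by-decision (block ++ tail₂)
    by-residue 2 (suc (suc q)) _ _ _ = family-star tail₂
      (λ X → windows-by-decision (block ++ block ++ tail₂ ++ block ++ block ++ X) 4)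
      (λ X → windows-by-decision (block ++ tail₂ ++ block ++ block ++ X) 4)
      (λ X → windows-by-decision (tail₂ ++ block ++ block ++ X) 2) q
    by-residue 3 0 _ _ (s≤s (s≤s (s≤s ())))
    by-residue 3 1 _ _ _ = word-star-by-decision (block ++ tail₃)
    by-residue 3 (suc (suc q)) _ _ _ = family-star tail₃
      (λ X → windows-by-decision (block ++ block ++ tail₃ ++ block ++ block ++ X) 4)
      (λ X → windows-by-decision (block ++ tail₃ ++ block ++ block ++ X) 4)
      (λ X → windows-by-decision (tail₃ ++ block ++ block ++ X) 3) q
    by-residue (suc (suc (suc (suc _)))) _ (s≤s (s≤s (s≤s (s≤s ())))) _ _

starColourable₆ : StarColourable (Prism 3) 6
starColourable₆ = word-star-by-decision triangle

-- Exhaustive search over local constraints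

at : ∀ {A : Set} → List A → ℕ → Maybe A
at []       _       = nothing
at (x ∷ _)  zero    = just x
at (_ ∷ xs) (suc i) = at xs i

at-++ : ∀ {A : Set} (xs ys : List A) i {x} → at xs i ≡ just x → at (xs ++ ys) i ≡ just x
at-++ (x ∷ xs) ys zero    e = e
at-++ (x ∷ xs) ys (suc i) e = at-++ xs ys i e

module _ {k : ℕ} where

  _≈ᵇ_ : Maybe (Fin k) → Maybe (Fin k) → Bool
  just x ≈ᵇ just y = does (x ≟ᶠ y)
  _      ≈ᵇ _      = false

  ≈ᵇ-sound : ∀ {u v} → T (u ≈ᵇ v) → Σ (Fin k) λ x → u ≡ just x × v ≡ just x
  ≈ᵇ-sound {just x} {just y} t with x ≟ᶠ y
  ... | yes refl = x , refl , refl

  Same : List (Fin k) → ℕ → ℕ → Bool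
  Same xs i j = at xs i ≈ᵇ at xs j

  Same-complete : ∀ xs {i j x} → at xs i ≡ just x → at xs j ≡ just x → T (Same xs i j)
  Same-complete xs {x = x} ei ej rewrite ei | ej with x ≟ᶠ x
  ... | yes _   = _
  ... | no x≢x = x≢x refl

  Same-++ : ∀ xs ys {i j} → T (Same xs i j) → T (Same (xs ++ ys) i j)
  Same-++ xs ys {i} {j} t with ≈ᵇ-sound {at xs i} {at xs j} t
  ... | _ , ei , ej = Same-complete (xs ++ ys) (at-++ xs ys i ei) (at-++ xs ys j ej)

  Same-sound : ∀ xs {i j x y} → at xs i ≡ just x → at xs j ≡ just y → T (Same xs i j) → x ≡ y
  Same-sound xs ei ej t with ≈ᵇ-sound t
  ... | _ , ei′ , ej′ = just-injective (trans (sym ei) (trans ei′ (trans (sym ej′) ej)))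

every : ∀ {k} → (Fin k → Bool) → Bool
every {zero}  f = true
every {suc k} f = f zero ∧ every (f ∘ suc)

every-sound : ∀ {k} (f : Fin k → Bool) → T (every f) → ∀ x → T (f x)
every-sound {suc k} f t zero    = proj₁ (Equivalence.to (T-∧ {f zero}) t)
every-sound {suc k} f t (suc x) = every-sound (f ∘ suc) (proj₂ (Equivalence.to (T-∧ {f zero}) t)) x

module Search {k : ℕ} {Constraint : Set}
              (violated : Constraint → List (Fin k) → Bool)
              (violated-++ : ∀ c xs ys → T (violated c xs) → T (violated c (xs ++ ys)))
              (goal : List (Fin k) → Bool) where

  search : List (List Constraint) → List (Fin k) → Bool
  search []       prefix = goal prefix
  search (b ∷ bs) prefix = every λ x → any (λ c → violated c (prefix ∷ʳ x)) b ∨ search bs (prefix ∷ʳ x)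

  search-sound : ∀ bs prefix → T (search bs prefix) → ∀ rest → length rest ≡ length bs →
                 (∀ {b c} → b ∈ bs → c ∈ b → ¬ T (violated c (prefix ++ rest))) → T (goal (prefix ++ rest))
  search-sound []       prefix t []         _   _  = subst (T ∘ goal) (sym (++-identityʳ prefix)) t
  search-sound (b ∷ bs) prefix t (x ∷ rest) len ok
    with Equivalence.to (T-∨ {any (λ c → violated c (prefix ∷ʳ x)) b}) (every-sound _ t x)
  ... | inj₁ some-violated with find (any⁻ _ b some-violated)
  ...   | c , c∈b , c-violated =
    ⊥-elim (ok (here refl) c∈b (subst (T ∘ violated c) (∷ʳ-++ prefix x rest) (violated-++ c (prefix ∷ʳ x) rest c-violated)))
  search-sound (b ∷ bs) prefix t (x ∷ rest) len ok | inj₂ t′ =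
    subst (T ∘ goal) (∷ʳ-++ prefix x rest)
      (search-sound bs (prefix ∷ʳ x) t′ rest (suc-injective len)
        λ b∈ c∈ v → ok (there b∈) c∈ (subst (T ∘ violated _) (∷ʳ-++ prefix x rest) v))

data Item : Set where
  pair : Local → Step → Step → Item
  walk : Local → Step → Step → Step → Step → Item

-- How window columns 0 … width-1 sit on the cycle: window column p is stored at fold p, and
-- Apartness p p' guarantees that columns p and p' are different positions of the cycle.
record Geometry : Set₁ where
  field
    width     : ℕ
    fold      : ℕ → ℕ
    Apartness : ℕ → ℕ → Set
    apart?    : ∀ p p' → Dec (Apartness p p')
    centres   : List ℕ

steps : List Step
steps = rung ∷ right ∷ left ∷ []

layers : List Layer
layers = zero ∷ suc zero ∷ []

admissible? : ∀ s p → Dec (Admissible s p)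
admissible? rung  p = yes tt
admissible? right p = yes tt
admissible? left  p = 1 ≤? p

module Constraints (G : Geometry) where
  open Geometry G

  index : Step → Local → ℕ
  index s (p , a) = fold (column s p) * 3 + toℕ (kind s a)

  Observable : Step → Local → Set
  Observable s (p , a) = Admissible s p × index s (p , a) < width * 3

  observable? : ∀ s l → Dec (Observable s l)
  observable? s (p , a) = admissible? s p ×-dec (index s (p , a) <? width * 3)

  Apart : Local → Local → Set
  Apart (p , a) (p' , a') = a ≢ a' ⊎ Apartness p p'

  Apart? : ∀ l l' → Dec (Apart l l')
  Apart? (p , a) (p' , a') = ¬? (a ≟ᶠ a') ⊎-dec apart? p p'

  Valid : Item → Set
  Valid (pair l s s') = Observable s l × Observable s' l × Apart (move s l) (move s' l)
  Valid (walk l₀ s₁ s₂ s₃ s₄) =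
    Observable s₁ l₀ × Observable s₂ l₁ × Observable s₃ l₂ × Observable s₄ l₃ ×
    Apart l₀ l₁ × Apart l₀ l₂ × Apart l₀ l₃ × Apart l₁ l₂ × Apart l₁ l₃ × Apart l₂ l₃ × Apart l₄ l₁ × Apart l₄ l₂ × Apart l₄ l₃
    where
      l₁ l₂ l₃ l₄ : Local
      l₁ = move s₁ l₀
      l₂ = move s₂ l₁
      l₃ = move s₃ l₂
      l₄ = move s₄ l₃

  valid? : ∀ c → Dec (Valid c)
  valid? (pair l s s') = observable? s l ×-dec observable? s' l ×-dec Apart? (move s l) (move s' l)
  valid? (walk l₀ s₁ s₂ s₃ s₄) =
    observable? s₁ l₀ ×-dec observable? s₂ l₁ ×-dec observable? s₃ l₂ ×-dec observable? s₄ l₃ ×-dec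
    Apart? l₀ l₁ ×-dec Apart? l₀ l₂ ×-dec Apart? l₀ l₃ ×-dec Apart? l₁ l₂ ×-dec Apart? l₁ l₃ ×-dec
    Apart? l₂ l₃ ×-dec Apart? l₄ l₁ ×-dec Apart? l₄ l₂ ×-dec Apart? l₄ l₃
    where
      l₁ l₂ l₃ l₄ : Local
      l₁ = move s₁ l₀
      l₂ = move s₂ l₁
      l₃ = move s₃ l₂
      l₄ = move s₄ l₃

  violated : ∀ {k} → Item → List (Fin k) → Bool
  violated (pair l s s') xs = Same xs (index s l) (index s' l)
  violated (walk l₀ s₁ s₂ s₃ s₄) xs = Same xs (index s₁ l₀) (index s₃ l₂) ∧ Same xs (index s₂ l₁) (index s₄ l₃)
    where
      l₁ l₂ l₃ : Local
      l₁ = move s₁ l₀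
      l₂ = move s₂ l₁
      l₃ = move s₃ l₂

  violated-++ : ∀ {k} c (xs ys : List (Fin k)) → T (violated c xs) → T (violated c (xs ++ ys))
  violated-++ (pair l s s') xs ys t = Same-++ xs ys t
  violated-++ (walk l₀ s₁ s₂ s₃ s₄) xs ys t with Equivalence.to (T-∧ {Same xs _ _}) t
  ... | t₁ , t₂ = Equivalence.from T-∧ (Same-++ xs ys t₁ , Same-++ xs ys t₂)

  lastIndex : Item → ℕ
  lastIndex (pair l s s') = index s l ⊔ index s' l
  lastIndex (walk l₀ s₁ s₂ s₃ s₄) = index s₁ l₀ ⊔ index s₂ l₁ ⊔ index s₃ l₂ ⊔ index s₄ l₃
    where
      l₁ l₂ l₃ : Local
      l₁ = move s₁ l₀
      l₂ = move s₂ l₁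
      l₃ = move s₃ l₂

  candidates : List Item
  candidates = concatMap (λ p → concatMap (λ a → at-centre (p , a)) layers) centres
    where
      at-centre : Local → List Item
      at-centre l = concatMap (λ s → map (pair l s) steps) steps
                 ++ concatMap (λ s₁ → concatMap (λ s₂ → concatMap (λ s₃ → map (walk l s₁ s₂ s₃) steps) steps) steps) steps

  constraints : List Item
  constraints = filter valid? candidates

  -- Bucket n holds the constraints whose last position is n: they are tested once n is coloured.
  buckets : List (List Item)
  buckets = map (λ n → filter (λ c → lastIndex c ≟ n) constraints) (upTo (width * 3))

  bucket-valid : ∀ {b c} → b ∈ buckets → c ∈ b → Valid c
  bucket-valid b∈ c∈ with ∈-map⁻ (λ n → filter (λ c → lastIndex c ≟ n) constraints) b∈
  ... | n , _ , refl = proj₂ (∈-filter⁻ valid? {xs = candidates} (proj₁ (∈-filter⁻ (λ c → lastIndex c ≟ n) {xs = constraints} c∈)))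

  module _ {k : ℕ} (goal : List (Fin k) → Bool) where
    open Search (violated {k}) violated-++ goal public

    Refutes : Set
    Refutes = T (search buckets [])

observe : ∀ {k} → (ℕ → Slice k) → ℕ → List (Fin k)
observe w zero    = []
observe w (suc L) = w 0 ‼ zero ∷ w 0 ‼ suc zero ∷ w 0 ‼ suc (suc zero) ∷ observe (w ∘ suc) L

length-observe : ∀ {k} (w : ℕ → Slice k) L → length (observe w L) ≡ L * 3
length-observe w zero    = refl
length-observe w (suc L) = cong (3 +_) (length-observe (w ∘ suc) L)

at-observe : ∀ {k} (w : ℕ → Slice k) L {q} κ → q < L → at (observe w L) (q * 3 + toℕ κ) ≡ just (w q ‼ κ)
at-observe w (suc L) {zero}  zero           _         = refl
at-observe w (suc L) {zero}  (suc zero)     _         = refl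
at-observe w (suc L) {zero}  (suc (suc zero)) _       = refl
at-observe w (suc L) {suc q} κ              (s≤s q<L) = at-observe (w ∘ suc) L κ q<L

module Observation {m : ℕ} .{{_ : NonZero m}} (G : Geometry) (b : ℕ)
                   (fold-sound  : ∀ p → Cyclic.⟦_⟧ m (b + Geometry.fold G p) ≡ Cyclic.⟦_⟧ m (b + p))
                   (apart-sound : ∀ p p' → Geometry.Apartness G p p' → Cyclic.⟦_⟧ m (b + p) ≢ Cyclic.⟦_⟧ m (b + p'))
                   {k : ℕ} (C : EdgeColouring (Prism m) k) where
  open Geometry G
  open Constraints G

  observed : List (Fin k)
  observed = observe (window (slices C) b) width

  at-index : ∀ s l → Observable s l → at observed (index s l) ≡ just (col C (chart b l) (chart b (move s l)))
  at-index s (p , a) (adm , i<) = begin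
    at observed (fold (column s p) * 3 + toℕ (kind s a))
      ≡⟨ at-observe (window (slices C) b) width (kind s a) (*-cancelʳ-< 3 _ width (≤-<-trans (m≤m+n _ _) i<)) ⟩
    just (slices C (b + fold (column s p)) ‼ kind s a)
      ≡⟨ cong (λ z → just (z ‼ kind s a)) (slices-cong C (fold-sound (column s p))) ⟩
    just (slices C (b + column s p) ‼ kind s a)
      ≡⟨ cong just (step-colour C b s (p , a) adm) ⟨
    just (col C (chart b (p , a)) (chart b (move s (p , a)))) ∎
    where open ≡-Reasoning

  Apart⇒chart≢ : ∀ {l l'} → Apart l l' → chart b l ≢ chart b l'
  Apart⇒chart≢ (inj₁ a≢a') e = a≢a' (cong proj₂ e)
  Apart⇒chart≢ (inj₂ ap)   e = apart-sound _ _ ap (cong proj₁ e)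

  same-colour : ∀ {s l s' l'} → Observable s l → Observable s' l' → T (Same observed (index s l) (index s' l')) →
                col C (chart b l) (chart b (move s l)) ≡ col C (chart b l') (chart b (move s' l'))
  same-colour o o' = Same-sound observed (at-index _ _ o) (at-index _ _ o')

  unviolated : StarEdgeColouring (Prism m) k C → ∀ c → Valid c → ¬ T (violated c observed)
  unviolated (proper , _) (pair l s s') (o , o' , ap) t =
    proper (chart b (move s l)) (chart b l) (chart b (move s' l)) (Adj-Prism-sym uv) (step-Adj b s' l (proj₁ o'))
      (Apart⇒chart≢ ap) (trans (EdgeColouring.sym C _ _ (Adj-Prism-sym uv)) (same-colour o o' t))
    where
      uv : Adj (Prism m) (chart b l) (chart b (move s l))
      uv = step-Adj b s l (proj₁ o)
  unviolated (_ , no-bichromatic) (walk l₀ s₁ s₂ s₃ s₄) (o₁ , o₂ , o₃ , o₄ , d₀₁ , d₀₂ , d₀₃ , d₁₂ , d₁₃ , d₂₃ , d₄₁ , d₄₂ , d₄₃) t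
    with Equivalence.to (T-∧ {Same observed _ _}) t
  ... | t₁ , t₂ =
    no-bichromatic (chart b l₀) (chart b l₁) (chart b l₂) (chart b l₃) (chart b l₄)
      (step-Adj b s₁ l₀ (proj₁ o₁)) (step-Adj b s₂ l₁ (proj₁ o₂)) (step-Adj b s₃ l₂ (proj₁ o₃)) (step-Adj b s₄ l₃ (proj₁ o₄))
      (Apart⇒chart≢ d₀₁) (Apart⇒chart≢ d₀₂) (Apart⇒chart≢ d₀₃) (Apart⇒chart≢ d₁₂) (Apart⇒chart≢ d₁₃)
      (Apart⇒chart≢ d₂₃) (Apart⇒chart≢ d₄₁) (Apart⇒chart≢ d₄₂) (Apart⇒chart≢ d₄₃)
      (same-colour o₁ o₃ t₁ , same-colour o₂ o₄ t₂)
    where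
      l₁ l₂ l₃ l₄ : Local
      l₁ = move s₁ l₀
      l₂ = move s₂ l₁
      l₃ = move s₃ l₂
      l₄ = move s₄ l₃

  refute : StarEdgeColouring (Prism m) k C → ∀ goal → Refutes goal → T (goal observed)
  refute star goal t = search-sound goal buckets [] t observed
    (trans (length-observe (window (slices C) b) width) (sym (trans (length-map (λ n → filter (λ c → lastIndex c ≟ n) constraints) (upTo (width * 3))) (length-upTo (width * 3)))))
    (λ b∈ c∈ → unviolated star _ (bucket-valid b∈ c∈))

-- Lower bounds

StarColourable-mono : ∀ {G j k} → j ≤ k → StarColourable G j → StarColourable G k
StarColourable-mono {G} {j} {k} j≤k (C , proper , no-bichromatic) = C′ , proper′ , no-bichromatic′
  where
    C′ : EdgeColouring G k
    C′ = record { col = λ u v → inject≤ (col C u v) j≤k ; sym = λ u v uv → cong (λ c → inject≤ c j≤k) (EdgeColouring.sym C u v uv) }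
    injective : ∀ {c c′} → inject≤ c j≤k ≡ inject≤ c′ j≤k → c ≡ c′
    injective = inject≤-injective j≤k j≤k _ _
    proper′ : Proper C′
    proper′ u v w uv vw u≢w e = proper u v w uv vw u≢w (injective e)
    no-bichromatic′ : NoBichromatic4 C′
    no-bichromatic′ v₀ v₁ v₂ v₃ v₄ a₀₁ a₁₂ a₂₃ a₃₄ n₀₁ n₀₂ n₀₃ n₁₂ n₁₃ n₂₃ n₄₁ n₄₂ n₄₃ (e₀₂ , e₁₃) =
      no-bichromatic v₀ v₁ v₂ v₃ v₄ a₀₁ a₁₂ a₂₃ a₃₄ n₀₁ n₀₂ n₀₃ n₁₂ n₁₃ n₂₃ n₄₁ n₄₂ n₄₃ (injective e₀₂ , injective e₁₃)

period-four : ∀ {A : Set} (f : ℕ → A) m → (∀ x → f (x + 4) ≡ f x) → (∀ x → f (x + m) ≡ f x) →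
              (∀ x → f x ≢ f (x + 2)) → m % 4 ≡ 0
period-four f m four period two = residue (m % 4) (m%n<n m 4) shift
  where
    multiple : ∀ q x → f (x + q * 4) ≡ f x
    multiple zero    x = cong f (+-identityʳ x)
    multiple (suc q) x = trans (cong f (sym (+-assoc x 4 (q * 4)))) (trans (multiple q (x + 4)) (four x))
    shift : ∀ x → f (x + m % 4) ≡ f x
    shift x = begin
      f (x + m % 4)                 ≡⟨ multiple (m / 4) (x + m % 4) ⟨
      f (x + m % 4 + m / 4 * 4)     ≡⟨ cong f (trans (+-assoc x _ _) (cong (x +_) (sym (m≡m%n+[m/n]*n m 4)))) ⟩
      f (x + m)                     ≡⟨ period x ⟩
      f x                           ∎
      where open ≡-Reasoning
    residue : ∀ r → r < 4 → (∀ x → f (x + r) ≡ f x) → r ≡ 0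
    residue 0 _ _ = refl
    residue 1 _ h = ⊥-elim (two 0 (sym (trans (h 1) (h 0))))
    residue 2 _ h = ⊥-elim (two 0 (sym (h 0)))
    residue 3 _ h = ⊥-elim (two 0 (sym (trans (h′ 1) (h′ 0))))
      where
        h′ : ∀ x → f (x + 1) ≡ f x
        h′ x = trans (sym (h (x + 1))) (trans (cong f (+-assoc x 1 3)) (four x))
    residue (suc (suc (suc (suc _)))) (s≤s (s≤s (s≤s (s≤s ())))) _

module _ (m : ℕ) .{{_ : NonZero m}} where
  open Cyclic m

  -- The whole cycle as a window, columns read modulo m.
  wrapped : Geometry
  wrapped = record
    { width = m ; fold = _% m ; Apartness = λ p p' → p % m ≢ p' % m
    ; apart? = λ p p' → ¬? (p % m ≟ p' % m) ; centres = map (4 +_) (upTo m) }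

  wrapped-fold : ∀ b p → ⟦ b + p % m ⟧ ≡ ⟦ b + p ⟧
  wrapped-fold b p = ⟦+⟧-congˡ b (⟦%⟧ p)

  wrapped-apart : ∀ b p p' → p % m ≢ p' % m → ⟦ b + p ⟧ ≢ ⟦ b + p' ⟧
  wrapped-apart b p p' ne e = ne (⟦⟧≡⇒%≡ (⟦+⟧-cancelˡ b e))

  module Wrapped {k} (C : EdgeColouring (Prism m) k) = Observation wrapped 0 (wrapped-fold 0) (wrapped-apart 0) C

-- L consecutive columns of a cycle of length at least 5, where columns at distance at most 4 differ.
straight : ℕ → Geometry
straight L = record
  { width = L ; fold = id ; Apartness = λ p p' → p ≢ p' × ∣ p - p' ∣ ≤ 4
  ; apart? = λ p p' → ¬? (p ≟ p') ×-dec (∣ p - p' ∣ ≤? 4) ; centres = upTo (suc L) }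

module _ {m : ℕ} .{{_ : NonZero m}} (5≤m : 5 ≤ m) where
  open Cyclic m

  straight-apart : ∀ b p p' → p ≢ p' × ∣ p - p' ∣ ≤ 4 → ⟦ b + p ⟧ ≢ ⟦ b + p' ⟧
  straight-apart b p p' (p≢p' , d≤4) e =
    p≢p' (+-cancelˡ-≡ b p p' (⟦⟧-injective-within (subst (_< m) (sym (∣m+n-m+o∣≡∣n-o∣ b p p')) (≤-trans (s≤s d≤4) 5≤m)) e))

  module Straight (L : ℕ) (b : ℕ) {k} (C : EdgeColouring (Prism m) k) = Observation (straight L) b (λ _ → refl) (straight-apart b) C

unsatisfiable : ∀ {k} → List (Fin k) → Bool
unsatisfiable _ = false

¬starColourable₃ : ∀ {m} → 5 ≤ m → ¬ StarColourable (Prism m) 3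
¬starColourable₃ {m} 5≤m (C , star) = Straight.refute 5≤m 3 0 C star unsatisfiable _
  where
    instance
      m≢0 : NonZero m
      m≢0 = >-nonZero (≤-trans (s≤s z≤n) 5≤m)

triangle-¬starColourable₅ : ¬ StarColourable (Prism 3) 5
triangle-¬starColourable₅ (C , star) = Wrapped.refute 3 C star unsatisfiable _

square-¬starColourable₃ : ¬ StarColourable (Prism 4) 3
square-¬starColourable₃ (C , star) = Wrapped.refute 4 C star unsatisfiable _

-- Positions 1, 13 and 7 of an observed window hold the top edges of its columns 0, 4 and 2.
top-pattern : List (Fin 4) → Bool
top-pattern xs = Same xs 1 13 ∧ not (Same xs 1 7)

module _ {m : ℕ} .{{_ : NonZero m}} (5≤m : 5 ≤ m) {C : EdgeColouring (Prism m) 4} (star : StarEdgeColouring (Prism m) 4 C) where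

  module _ (b : ℕ) where
    open Straight 5≤m 6 b C

    at-top : ∀ q → q < 6 → at observed (q * 3 + 1) ≡ just (horizontal C zero (b + q))
    at-top q q<6 = trans (at-observe (window (slices C) b) 6 (suc zero) q<6) (cong just (slices‼suc C (b + q) zero))

    top-pattern-holds : T (top-pattern observed)
    top-pattern-holds = refute star top-pattern _

    top-period : horizontal C zero (b + 0) ≡ horizontal C zero (b + 4) × horizontal C zero (b + 0) ≢ horizontal C zero (b + 2)
    top-period = Same-sound observed {1} {13} (at-top 0 z<s) (at-top 4 (s<s (s<s (s<s (s<s z<s))))) (proj₁ split) ,
      λ e → subst T (Equivalence.to T-not-≡ (proj₂ split)) (Same-complete observed {1} {7} (at-top 0 z<s) (trans (at-top 2 (s<s (s<s z<s))) (cong just (sym e))))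
      where
        split : T (Same observed 1 13) × T (not (Same observed 1 7))
        split = Equivalence.to (T-∧ {Same observed 1 13}) top-pattern-holds

¬starColourable₄ : ∀ {m} → 5 ≤ m → m % 4 ≢ 0 → ¬ StarColourable (Prism m) 4
¬starColourable₄ {m} 5≤m m%4≢0 (C , star) = m%4≢0 (period-four (horizontal C zero) m
    (λ x → trans (sym (proj₁ (top-period′ x))) (cong (horizontal C zero) (+-identityʳ x)))
    (λ x → horizontal-cong C zero (⟦+m⟧ x))
    (λ x e → proj₂ (top-period′ x) (trans (cong (horizontal C zero) (+-identityʳ x)) e)))
  where
    instance
      m≢0 : NonZero m
      m≢0 = >-nonZero (≤-trans (s≤s z≤n) 5≤m)
    open Cyclic m
    top-period′ : ∀ x → horizontal C zero (x + 0) ≡ horizontal C zero (x + 4) × horizontal C zero (x + 0) ≢ horizontal C zero (x + 2)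
    top-period′ = top-period 5≤m {C} star

¬starColourable-<4 : ∀ m → 3 ≤ m → ∀ j → j < 4 → ¬ StarColourable (Prism m) j
¬starColourable-<4 1 (s≤s ()) _ _ _
¬starColourable-<4 2 (s≤s (s≤s ())) _ _ _
¬starColourable-<4 3 _ j j<4 c = triangle-¬starColourable₅ (StarColourable-mono (≤-trans (s≤s⁻¹ j<4) (s≤s (s≤s (s≤s z≤n)))) c)
¬starColourable-<4 4 _ j j<4 c = square-¬starColourable₃ (StarColourable-mono (s≤s⁻¹ j<4) c)
¬starColourable-<4 (suc (suc (suc (suc (suc m))))) _ j j<4 c = ¬starColourable₃ (s≤s (s≤s (s≤s (s≤s (s≤s z≤n))))) (StarColourable-mono (s≤s⁻¹ j<4) c)

five≤ : ∀ {m} → 3 ≤ m → m ≢ 3 → m % 4 ≢ 0 → 5 ≤ m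
five≤ {1} (s≤s ()) _ _
five≤ {2} (s≤s (s≤s ())) _ _
five≤ {3} _ m≢3 _ = ⊥-elim (m≢3 refl)
five≤ {4} _ _ m%4≢0 = ⊥-elim (m%4≢0 refl)
five≤ {suc (suc (suc (suc (suc m))))} _ _ _ = s≤s (s≤s (s≤s (s≤s (s≤s z≤n))))

theorem25 : (m : ℕ) → 3 ≤ m →
    (m ≡ 3 → StarChromaticIndex (Cycle m □ Path 2) 6)
    × (m % 4 ≡ 0 → StarChromaticIndex (Cycle m □ Path 2) 4)
    × (m ≢ 3 → m % 4 ≢ 0 → StarChromaticIndex (Cycle m □ Path 2) 5)
theorem25 m 3≤m = three , multiple-of-four , otherwise
  where
    three : m ≡ 3 → StarChromaticIndex (Prism m) 6
    three refl = starColourable₆ , λ j j<6 c → triangle-¬starColourable₅ (StarColourable-mono (s≤s⁻¹ j<6) c)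
    multiple-of-four : m % 4 ≡ 0 → StarChromaticIndex (Prism m) 4
    multiple-of-four m%4≡0 = starColourable₄ m 3≤m m%4≡0 , ¬starColourable-<4 m 3≤m
    otherwise : m ≢ 3 → m % 4 ≢ 0 → StarChromaticIndex (Prism m) 5
    otherwise m≢3 m%4≢0 = starColourable₅ m 5≤m m%4≢0 , λ j j<5 c → ¬starColourable₄ 5≤m m%4≢0 (StarColourable-mono (s≤s⁻¹ j<5) c)
      where
        5≤m : 5 ≤ m
        5≤m = five≤ 3≤m m≢3 m%4≢0
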